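{- Let $x$ be a rooted tree with $|x|=k+1$, and let $w=w_1w_2\cdots w_r$ be a word in the letters $\mathfrak N,\mathfrak P$ that is a valid $x$-word, i.e. (a) for each $1\le i\le r$ the number of occurrences of $\mathfrak P$ in $w_iw_{i+1}\cdots w_r$ does not exceed the number of occurrences of $\mathfrak N$ there, and (b) the number of $\mathfrak N$'s minus the number of $\mathfrak P$'s in $w$ equals $k$. Let $S=\{i:w_i=\mathfrak P\}$ and for $i\in S$ put $a_i=|\{j:j\ge i,\ w_j=\mathfrak P\}|$, $b_i=|\{j:j>i,\ w_j=\mathfrak N\}|$, $c_i=b_i-a_i$. Then, regarding $w$ as the composite operator $w_1\circ\cdots\circ w_r$ on $k\{\mathcal T\}$, $$(w\bullet,x)=m(\bullet;x)\prod_{i\in S}\binom{c_i+2}{2}.$$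
   Context: A rooted tree is a finite partially ordered set (elements called vertices) with a unique greatest element, the root, such that for every vertex $v$ the set of vertices greater than $v$ is a chain; if $v$ covers $w$, $w$ is a child of $v$. We regard it as a directed graph with edges from each vertex to its children; a vertex is terminal if it has no children. Rooted trees are considered up to isomorphism; $\mathcal T$ is the set of finite rooted trees, $|t|$ the number of vertices, $\bullet$ the one-vertex tree. Write $t\lhd t'$ if $t$ is obtained from $t'$ by deleting one terminal non-root vertex and the edge into it. For $t\lhd t'$, $n_1(t;t')$ is the number of vertices of $t$ at which attaching a new edge to a new terminal vertex yields $t'$, and $m_1(t;t')$ is the number of edges of $t'$ whose removal (with their terminal endpoint) leaves $t$. For a vertex $v$ of $t$, $t_v$ is the rooted tree of $v$ and its descendants; if $v$ has children $v_1,\dots,v_k$, $SG(t,v)$ is the group generated by the exchanges of $t_{v_i}$ with $t_{v_j}$ whenever isomorphic; $SG(t)=\prod_v SG(t,v)$. Let $k$ be a field of characteristic $0$ and $k\{\mathcal T\}$ the vector space with basis $\mathcal T$. Growth operator: linear map $\mathfrak N(t)=\sum_{t\lhd t'}n_1(t;t')t'$; pruning operator: linear map $\mathfrak P(t)=\sum_{t'\lhd t}m_1(t';t)t'$ for $t\ne\bullet$, $\mathfrak P(\bullet)=0$. Inner product: the bilinear form with $(t,t')=|SG(t)|\delta_{t,t'}$. For rooted trees with $|t'|-|t|=j\ge 0$, $m(t;t')$ is the coefficient of $t$ in $\mathfrak P^j(t')$. -}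

module Defs where

open import Data.Nat using (ℕ; zero; suc; _+_; _*_; _∸_; _≤_; _!)
open import Data.Nat.Combinatorics using (_C_)
open import Data.Bool using (Bool; true; false; if_then_else_; _∧_)
open import Data.List using (List; []; _∷_; _++_; map; concatMap; [_])
open import Data.Nat.ListAction using (sum)
open import Data.List.Relation.Unary.All using (All)
open import Data.Maybe using (Maybe; just; nothing)
open import Data.Product using (_×_; _,_)
open import Relation.Binary.PropositionalEquality using (_≡_)

-- Rooted trees.  A planar representative: a vertex with a list of
-- children.  Rooted trees up to isomorphism are handled by the
-- decidable isomorphism test `iso` below (no quotient types).

data Tree : Set where
  node : List Tree → Tree

• : Tree
• = node []

size     : Tree → ℕ
sizeList : List Tree → ℕ
size (node ts) = suc (sizeList ts)
sizeList []       = 0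
sizeList (t ∷ ts) = size t + sizeList ts

-- isomorphism of rooted trees: children lists agree as multisets up to
-- isomorphism (greedy matching; iso is an equivalence relation)
iso     : Tree → Tree → Bool
isoList : List Tree → List Tree → Bool
remove  : Tree → List Tree → Maybe (List Tree)
iso (node ts) (node us) = isoList ts us
isoList []       []      = true
isoList []       (_ ∷ _) = false
isoList (t ∷ ts) us with remove t us
... | nothing  = false
... | just us' = isoList ts us'
remove t []       = nothing
remove t (u ∷ us) with iso t u
... | true  = just us
... | false with remove t us
...   | nothing  = nothing
...   | just us' = just (u ∷ us')

-- |SG(t)| : SG(t,v) is generated by exchanges of isomorphic child
-- subtrees, i.e. it is the product of the symmetric groups on the
-- isomorphism classes of children of v; its order is the product of
-- (multiplicity)! over those classes.  |SG(t)| = ∏_v |SG(t,v)|.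

addClass : Tree → List (Tree × ℕ) → List (Tree × ℕ)
addClass t [] = (t , 1) ∷ []
addClass t ((s , m) ∷ cs) = if iso t s then (s , suc m) ∷ cs else (s , m) ∷ addClass t cs

classes : List Tree → List (Tree × ℕ)
classes []       = []
classes (t ∷ ts) = addClass t (classes ts)

classFact : List (Tree × ℕ) → ℕ
classFact []             = 1
classFact ((_ , m) ∷ cs) = (m !) * classFact cs

sgRoot : Tree → ℕ
sgRoot (node ts) = classFact (classes ts)

sg     : Tree → ℕ
sgList : List Tree → ℕ
sg (node ts) = sgRoot (node ts) * sgList ts
sgList []       = 1
sgList (t ∷ ts) = sg t * sgList ts

-- Vectors of k{T}: finite formal ℕ-linear combinations of trees,
-- represented as lists of (coefficient, tree); trees are compared up
-- to isomorphism.

Vect : Set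
Vect = List (ℕ × Tree)

coeff : Tree → Vect → ℕ
coeff t []             = 0
coeff t ((c , s) ∷ v) = (if iso t s then c else 0) + coeff t v

linExt : (Tree → Vect) → Vect → Vect
linExt f = concatMap (λ { (c , t) → map (λ { (d , s) → (c * d , s) }) (f t) })

graftAll : Tree → List Tree
graftIn  : List Tree → List (List Tree)
graftAll (node ts) = node (ts ++ [ • ]) ∷ map node (graftIn ts)
graftIn []       = []
graftIn (t ∷ ts) = map (λ g → g ∷ ts) (graftAll t) ++ map (λ gs → t ∷ gs) (graftIn ts)

pruneAll : Tree → List Tree
pruneIn  : List Tree → List (List Tree)
pruneAll (node ts) = map node (pruneIn ts)
pruneIn []                     = []
pruneIn (node [] ∷ ts)         = ts ∷ map (λ gs → • ∷ gs) (pruneIn ts)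
pruneIn (node (s ∷ ss) ∷ ts)   =
  map (λ g → g ∷ ts) (pruneAll (node (s ∷ ss)))
  ++ map (λ gs → node (s ∷ ss) ∷ gs) (pruneIn ts)

-- 𝔑(t) = Σ_{t ⊲ t'} n₁(t;t') t' , realized as the sum over vertices of t
growthT : Tree → Vect
growthT t = map (λ s → (1 , s)) (graftAll t)

-- 𝔓(t) = Σ_{t' ⊲ t} m₁(t';t) t' , realized as the sum over removable edges;
-- 𝔓(•) = 0 automatically
pruneT : Tree → Vect
pruneT t = map (λ s → (1 , s)) (pruneAll t)

𝔑 : Vect → Vect
𝔑 = linExt growthT

𝔓 : Vect → Vect
𝔓 = linExt pruneT

iter : ℕ → (Vect → Vect) → Vect → Vect
iter zero    f v = v
iter (suc n) f v = f (iter n f v)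

⟪_,_⟫ : Vect → Vect → ℕ
⟪ u , v ⟫ = sum (map (λ { (c , t) → sum (map (λ { (d , s) →
              (if iso t s then c * d * sg t else 0) }) v) }) u)

m : Tree → Tree → ℕ
m t t' = coeff t (iter (size t' ∸ size t) 𝔓 ((1 , t') ∷ []))

data Letter : Set where
  N P : Letter

opL : Letter → Vect → Vect
opL N = 𝔑
opL P = 𝔓

applyWord : List Letter → Vect → Vect
applyWord []      v = v
applyWord (l ∷ w) v = opL l (applyWord w v)

#N : List Letter → ℕ
#N []      = 0
#N (N ∷ w) = suc (#N w)
#N (P ∷ w) = #N w

#P : List Letter → ℕ
#P []      = 0
#P (N ∷ w) = #P w
#P (P ∷ w) = suc (#P w)

suffixes : List Letter → List (List Letter)
suffixes []      = []
suffixes (l ∷ w) = (l ∷ w) ∷ suffixes w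

ValidWord : ℕ → List Letter → Set
ValidWord k w = All (λ s → #P s ≤ #N s) (suffixes w) × (#N w ≡ #P w + k)

-- ∏_{i∈S} binom(c_i + 2, 2) with a_i = #𝔓 in w_i⋯w_r,
-- b_i = #𝔑 in w_{i+1}⋯w_r, c_i = b_i - a_i (≥ 0 for valid words)
binomProd : List Letter → ℕ
binomProd []      = 1
binomProd (N ∷ w) = binomProd w
binomProd (P ∷ w) = (((#N w ∸ #P (P ∷ w)) + 2) C 2) * binomProd w

-- Pair everything with weight functions φ : Tree → ℕ, on which growth and pruning act through
-- their transposes 𝔑ᵀ φ t = Σ_{t ⊲ g} n₁(t;g) φ g and 𝔓ᵀ φ t = Σ_{p ⊲ t} m₁(p;t) φ p.
-- The commutation relation 𝔓𝔑 = 𝔑𝔓 + |·| and the fact that 𝔑ʲ• is spanned by trees with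
-- j + 1 vertices give 𝔓𝔑ʲ⁺¹• = C(j+2,2) 𝔑ʲ•.  Reading a valid word from the right, the vector
-- is always a multiple of some 𝔑ʲ•, and the letter 𝔓 at position i multiplies it by
-- C(cᵢ+2,2); hence w• = ∏_{i∈S} C(cᵢ+2,2) 𝔑ᵏ•.  Finally 𝔑 and 𝔓 are adjoint for ( , ), so
-- (𝔑ᵏ•, x) = (•, 𝔓ᵏx) = m(•;x).  Adjointness is proved by expanding ( , ) along the first
-- child of the root, where |SG| contributes one plus the number of siblings isomorphic to it.

module Submission where

open import Defs
open import Data.Nat using (ℕ; zero; suc; _+_; _*_; _∸_; _≤_; z≤n; s≤s; _!)
open import Data.Nat.Properties
open import Data.Nat.Combinatorics using (_C_; nC1≡n; nCk+nC[k+1]≡[n+1]C[k+1])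
open import Data.Nat.ListAction using (sum)
open import Data.Nat.ListAction.Properties using (sum-↭)
open import Data.Nat.Tactic.RingSolver using (solve-∀)
open import Data.Bool using (Bool; true; false; if_then_else_)
open import Data.Bool.Properties using (⇔→≡)
open import Data.Maybe using (just; nothing)
open import Data.List using (List; []; _∷_; _++_; map; [_])
open import Data.List.Relation.Unary.All as All using (All; []; _∷_)
open import Data.List.Relation.Unary.All.Properties using (map⁺; ++⁺)
open import Data.List.Relation.Unary.AllPairs using (AllPairs; []; _∷_)
open import Data.List.Relation.Unary.Any using (here; there)
open import Data.List.Membership.Propositional.Properties using (∈-∃++)
open import Data.List.Relation.Binary.Pointwise as Pointwise using (Pointwise; []; _∷_)
open import Data.List.Relation.Binary.Permutation.Propositional as ↭
  using (_↭_; prep; swap; ↭-refl; ↭-sym; ↭-trans)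
open import Data.List.Relation.Binary.Permutation.Propositional.Properties
  using (shift; drop-∷; ∈-resp-↭; All-resp-↭; ↭-empty-inv) renaming (map⁺ to ↭-map⁺)
open import Data.Product using (_×_; _,_; proj₁; proj₂; ∃-syntax; map₂; uncurry)
open import Data.Empty using (⊥-elim)
open import Function using (_∘_; mk⇔)
open import Relation.Binary.PropositionalEquality hiding ([_]; J)
open ≡-Reasoning
import Algebra.Properties.CommutativeSemigroup as CommutativeSemigroupProperties

private variable A B : Set

module +-CS = CommutativeSemigroupProperties +-commutativeSemigroup
module *-CS = CommutativeSemigroupProperties *-commutativeSemigroup

∑ : List A → (A → ℕ) → ℕ
∑ []       f = 0
∑ (x ∷ xs) f = f x + ∑ xs f

∑-++ : (xs ys : List A) (f : A → ℕ) → ∑ (xs ++ ys) f ≡ ∑ xs f + ∑ ys f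
∑-++ []       ys f = refl
∑-++ (x ∷ xs) ys f = trans (cong (f x +_) (∑-++ xs ys f)) (sym (+-assoc (f x) _ _))

∑-map : (g : A → B) (xs : List A) (f : B → ℕ) → ∑ (map g xs) f ≡ ∑ xs (f ∘ g)
∑-map g []       f = refl
∑-map g (x ∷ xs) f = cong (f (g x) +_) (∑-map g xs f)

∑-cong : (xs : List A) {f g : A → ℕ} → (∀ x → f x ≡ g x) → ∑ xs f ≡ ∑ xs g
∑-cong []       f≗g = refl
∑-cong (x ∷ xs) f≗g = cong₂ _+_ (f≗g x) (∑-cong xs f≗g)

∑-cong-All : {xs : List A} {f g : A → ℕ} → All (λ x → f x ≡ g x) xs → ∑ xs f ≡ ∑ xs g
∑-cong-All []            = refl
∑-cong-All (fx≡gx ∷ eqs) = cong₂ _+_ fx≡gx (∑-cong-All eqs)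

∑-zero : (xs : List A) → ∑ xs (λ _ → 0) ≡ 0
∑-zero []       = refl
∑-zero (x ∷ xs) = ∑-zero xs

∑-+ : (xs : List A) (f g : A → ℕ) → ∑ xs (λ x → f x + g x) ≡ ∑ xs f + ∑ xs g
∑-+ []       f g = refl
∑-+ (x ∷ xs) f g = begin
  f x + g x + ∑ xs (λ x → f x + g x) ≡⟨ cong (f x + g x +_) (∑-+ xs f g) ⟩
  f x + g x + (∑ xs f + ∑ xs g)      ≡⟨ +-CS.interchange (f x) (g x) _ _ ⟩
  f x + ∑ xs f + (g x + ∑ xs g)      ∎

∑-+₃ : (xs : List A) (f g h : A → ℕ) →
  ∑ xs (λ x → f x + g x + h x) ≡ ∑ xs f + ∑ xs g + ∑ xs h
∑-+₃ xs f g h = trans (∑-+ xs _ h) (cong (_+ ∑ xs h) (∑-+ xs f g))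

∑-*ˡ : (c : ℕ) (xs : List A) (f : A → ℕ) → ∑ xs (λ x → c * f x) ≡ c * ∑ xs f
∑-*ˡ c []       f = sym (*-zeroʳ c)
∑-*ˡ c (x ∷ xs) f = trans (cong (c * f x +_) (∑-*ˡ c xs f)) (sym (*-distribˡ-+ c (f x) _))

∑-*ʳ : (c : ℕ) (xs : List A) (f : A → ℕ) → ∑ xs (λ x → f x * c) ≡ ∑ xs f * c
∑-*ʳ c xs f = trans (∑-cong xs (λ x → *-comm (f x) c)) (trans (∑-*ˡ c xs f) (*-comm c _))

∑-comm : (xs : List A) (ys : List B) (f : A → B → ℕ) →
  ∑ xs (λ x → ∑ ys (f x)) ≡ ∑ ys (λ y → ∑ xs (λ x → f x y))
∑-comm []       ys f = sym (∑-zero ys)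
∑-comm (x ∷ xs) ys f = trans (cong (∑ ys (f x) +_) (∑-comm xs ys f)) (sym (∑-+ ys (f x) _))

-- Transposes of growth and pruning

eval : (Tree → ℕ) → Vect → ℕ
eval φ []            = 0
eval φ ((c , t) ∷ v) = c * φ t + eval φ v

eval-++ : (φ : Tree → ℕ) (u v : Vect) → eval φ (u ++ v) ≡ eval φ u + eval φ v
eval-++ φ []            v = refl
eval-++ φ ((c , t) ∷ u) v = trans (cong (c * φ t +_) (eval-++ φ u v)) (sym (+-assoc (c * φ t) _ _))

eval-cong : (v : Vect) {φ ψ : Tree → ℕ} → (∀ t → φ t ≡ ψ t) → eval φ v ≡ eval ψ v
eval-cong []            φ≗ψ = refl
eval-cong ((c , t) ∷ v) φ≗ψ = cong₂ (λ a b → c * a + b) (φ≗ψ t) (eval-cong v φ≗ψ)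

eval-scale : (φ : Tree → ℕ) (c : ℕ) {g : ℕ × Tree → ℕ × Tree} → (∀ d s → g (d , s) ≡ (c * d , s)) →
  (u : Vect) → eval φ (map g u) ≡ c * eval φ u
eval-scale φ c g≡scale []            = sym (*-zeroʳ c)
eval-scale φ c g≡scale ((d , s) ∷ u) rewrite g≡scale d s = begin
  c * d * φ s + eval φ (map _ u)   ≡⟨ cong₂ _+_ (*-assoc c d (φ s)) (eval-scale φ c g≡scale u) ⟩
  c * (d * φ s) + c * eval φ u     ≡⟨ *-distribˡ-+ c _ _ ⟨
  c * (d * φ s + eval φ u)         ∎

eval-linExt : (φ : Tree → ℕ) (f : Tree → Vect) (v : Vect) → eval φ (linExt f v) ≡ eval (eval φ ∘ f) v
eval-linExt φ f []            = refl
eval-linExt φ f ((c , t) ∷ v) = trans (eval-++ φ (map _ (f t)) (linExt f v))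
  (cong₂ _+_ (eval-scale φ c (λ d s → refl) (f t)) (eval-linExt φ f v))

eval-units : (φ : Tree → ℕ) (ts : List Tree) → eval φ (map (λ s → (1 , s)) ts) ≡ ∑ ts φ
eval-units φ []       = refl
eval-units φ (t ∷ ts) = cong₂ _+_ (+-identityʳ (φ t)) (eval-units φ ts)

𝔑ᵀ : (Tree → ℕ) → Tree → ℕ
𝔑ᵀ φ t = ∑ (graftAll t) φ

𝔓ᵀ : (Tree → ℕ) → Tree → ℕ
𝔓ᵀ φ t = ∑ (pruneAll t) φ

eval-𝔑 : (φ : Tree → ℕ) (v : Vect) → eval φ (𝔑 v) ≡ eval (𝔑ᵀ φ) v
eval-𝔑 φ v = trans (eval-linExt φ growthT v) (eval-cong v (eval-units φ ∘ graftAll))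

eval-𝔓 : (φ : Tree → ℕ) (v : Vect) → eval φ (𝔓 v) ≡ eval (𝔓ᵀ φ) v
eval-𝔓 φ v = trans (eval-linExt φ pruneT v) (eval-cong v (eval-units φ ∘ pruneAll))

-- The commutation relation

graftForest : List Tree → List (List Tree)
graftForest ts = (ts ++ [ • ]) ∷ graftIn ts

𝔑ᵀ-node : (φ : Tree → ℕ) (ts : List Tree) → 𝔑ᵀ φ (node ts) ≡ ∑ (graftForest ts) (φ ∘ node)
𝔑ᵀ-node φ ts = ∑-map node (graftForest ts) φ

𝔓ᵀ-node : (φ : Tree → ℕ) (ts : List Tree) → 𝔓ᵀ φ (node ts) ≡ ∑ (pruneIn ts) (φ ∘ node)
𝔓ᵀ-node φ ts = ∑-map node (pruneIn ts) φ

∑-graftForest-∷ : (t : Tree) (ts : List Tree) (ψ : List Tree → ℕ) →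
  ∑ (graftForest (t ∷ ts)) ψ ≡ 𝔑ᵀ (λ g → ψ (g ∷ ts)) t + ∑ (graftForest ts) (λ q → ψ (t ∷ q))
∑-graftForest-∷ t ts ψ = begin
  ψ (t ∷ ts ++ [ • ]) + ∑ (map _ (graftAll t) ++ map _ (graftIn ts)) ψ
    ≡⟨ cong (ψ (t ∷ ts ++ [ • ]) +_) (trans (∑-++ (map _ (graftAll t)) _ ψ)
         (cong₂ _+_ (∑-map _ (graftAll t) ψ) (∑-map _ (graftIn ts) ψ))) ⟩
  ψ (t ∷ ts ++ [ • ]) + (𝔑ᵀ (λ g → ψ (g ∷ ts)) t + ∑ (graftIn ts) (λ q → ψ (t ∷ q)))
    ≡⟨ +-CS.x∙yz≈y∙xz (ψ (t ∷ ts ++ [ • ])) (𝔑ᵀ (λ g → ψ (g ∷ ts)) t)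
                      (∑ (graftIn ts) (λ q → ψ (t ∷ q))) ⟩
  𝔑ᵀ (λ g → ψ (g ∷ ts)) t + ∑ (graftForest ts) (λ q → ψ (t ∷ q)) ∎

isLeaf : Tree → ℕ
isLeaf (node [])      = 1
isLeaf (node (_ ∷ _)) = 0

∑-pruneIn-∷ : (t : Tree) (ts : List Tree) (ψ : List Tree → ℕ) →
  ∑ (pruneIn (t ∷ ts)) ψ ≡
  𝔓ᵀ (λ p → ψ (p ∷ ts)) t + isLeaf t * ψ ts + ∑ (pruneIn ts) (λ q → ψ (t ∷ q))
∑-pruneIn-∷ (node [])       ts ψ =
  cong₂ _+_ (sym (+-identityʳ (ψ ts))) (∑-map _ (pruneIn ts) ψ)
∑-pruneIn-∷ (node (s ∷ ss)) ts ψ =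
  trans (∑-++ (map _ (pruneAll (node (s ∷ ss)))) _ ψ)
    (cong₂ _+_ (trans (∑-map _ (pruneAll (node (s ∷ ss))) ψ) (sym (+-identityʳ _))) (∑-map _ (pruneIn ts) ψ))

sizeList-++-• : (ts : List Tree) → sizeList (ts ++ [ • ]) ≡ suc (sizeList ts)
sizeList-++-• []       = refl
sizeList-++-• (t ∷ ts) = trans (cong (size t +_) (sizeList-++-• ts)) (+-suc (size t) (sizeList ts))

size-graftAll    : (t : Tree) → All (λ g → size g ≡ suc (size t)) (graftAll t)
sizeList-graftIn : (ts : List Tree) → All (λ gs → sizeList gs ≡ suc (sizeList ts)) (graftIn ts)
size-graftAll (node ts) = cong suc (sizeList-++-• ts) ∷ map⁺ (All.map (cong suc) (sizeList-graftIn ts))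
sizeList-graftIn []       = []
sizeList-graftIn (t ∷ ts) = ++⁺
  (map⁺ (All.map (cong (_+ sizeList ts)) (size-graftAll t)))
  (map⁺ (All.map (λ eq → trans (cong (size t +_) eq) (+-suc (size t) (sizeList ts))) (sizeList-graftIn ts)))

𝔑ᵀ-size : (f : ℕ → ℕ) (φ : Tree → ℕ) (t : Tree) →
  𝔑ᵀ (λ u → f (size u) * φ u) t ≡ f (suc (size t)) * 𝔑ᵀ φ t
𝔑ᵀ-size f φ t = trans
  (∑-cong-All (All.map (λ {g} eq → cong (λ n → f n * φ g) eq) (size-graftAll t)))
  (∑-*ˡ (f (suc (size t))) (graftAll t) φ)

isLeaf-grafted : {g t : Tree} → size g ≡ suc (size t) → isLeaf g ≡ 0
isLeaf-grafted {node (_ ∷ _)} _  = refl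
isLeaf-grafted {node []} {node _} ()

𝔑ᵀ-isLeaf : (c : ℕ) (t : Tree) → 𝔑ᵀ (λ g → isLeaf g * c) t ≡ 0
𝔑ᵀ-isLeaf c t = trans
  (∑-cong-All (All.map (λ eq → cong (_* c) (isLeaf-grafted eq)) (size-graftAll t)))
  (∑-zero (graftAll t))

-- Growing t at one of its size t vertices and pruning the new leaf gives t back; every other
-- grow-then-prune pair corresponds to a prune-then-grow pair.
commutator : (t : Tree) (φ : Tree → ℕ) → 𝔑ᵀ (𝔓ᵀ φ) t ≡ 𝔓ᵀ (𝔑ᵀ φ) t + size t * φ t
forest-commutator : (ts : List Tree) (ψ : List Tree → ℕ) →
  ∑ (graftForest ts) (λ gs → ∑ (pruneIn gs) ψ) ≡
  ∑ (pruneIn ts) (λ ps → ∑ (graftForest ps) ψ) + suc (sizeList ts) * ψ ts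

commutator (node ts) φ = begin
  𝔑ᵀ (𝔓ᵀ φ) (node ts)
    ≡⟨ trans (𝔑ᵀ-node (𝔓ᵀ φ) ts) (∑-cong (graftForest ts) (𝔓ᵀ-node φ)) ⟩
  ∑ (graftForest ts) (λ gs → ∑ (pruneIn gs) (φ ∘ node))
    ≡⟨ forest-commutator ts (φ ∘ node) ⟩
  ∑ (pruneIn ts) (λ ps → ∑ (graftForest ps) (φ ∘ node)) + size (node ts) * φ (node ts)
    ≡⟨ cong (_+ size (node ts) * φ (node ts))
         (trans (∑-cong (pruneIn ts) (sym ∘ 𝔑ᵀ-node φ)) (sym (𝔓ᵀ-node (𝔑ᵀ φ) ts))) ⟩
  𝔓ᵀ (𝔑ᵀ φ) (node ts) + size (node ts) * φ (node ts) ∎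

forest-commutator []       ψ = +-identityʳ (ψ [] + 0)
forest-commutator (t ∷ ts) ψ = begin
  ∑ (graftForest (t ∷ ts)) (λ gs → ∑ (pruneIn gs) ψ)
    ≡⟨ ∑-graftForest-∷ t ts _ ⟩
  ∑ (graftAll t) (λ g → ∑ (pruneIn (g ∷ ts)) ψ) + ∑ (graftForest ts) (λ q → ∑ (pruneIn (t ∷ q)) ψ)
    ≡⟨ cong₂ _+_ grafts-at-t grafts-in-ts ⟩
  (PN + size t * c + 0 + X) + (Y + L + (Z + suc (sizeList ts) * c))
    ≡⟨ regroup PN (size t) c X Y L Z (sizeList ts) ⟩
  PN + Y + L + (X + Z) + suc (size t + sizeList ts) * c
    ≡⟨ cong (_+ suc (size t + sizeList ts) * c) (sym prunes) ⟩
  ∑ (pruneIn (t ∷ ts)) (λ ps → ∑ (graftForest ps) ψ) + suc (sizeList (t ∷ ts)) * c ∎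
  where
  c  = ψ (t ∷ ts)
  PN = 𝔓ᵀ (𝔑ᵀ (λ g → ψ (g ∷ ts))) t
  X  = ∑ (pruneIn ts) (λ q → 𝔑ᵀ (λ g → ψ (g ∷ q)) t)
  Y  = 𝔓ᵀ (λ p → ∑ (graftForest ts) (λ q → ψ (p ∷ q))) t
  L  = isLeaf t * ∑ (graftForest ts) ψ
  Z  = ∑ (pruneIn ts) (λ q → ∑ (graftForest q) (λ r → ψ (t ∷ r)))

  regroup : ∀ PN s c X Y L Z n →
    PN + s * c + 0 + X + (Y + L + (Z + suc n * c)) ≡ PN + Y + L + (X + Z) + suc (s + n) * c
  regroup = solve-∀

  grafts-at-t : ∑ (graftAll t) (λ g → ∑ (pruneIn (g ∷ ts)) ψ) ≡ PN + size t * c + 0 + X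
  grafts-at-t = begin
    ∑ (graftAll t) (λ g → ∑ (pruneIn (g ∷ ts)) ψ)
      ≡⟨ trans (∑-cong (graftAll t) (λ g → ∑-pruneIn-∷ g ts ψ))
           (∑-+₃ (graftAll t) (𝔓ᵀ (λ p → ψ (p ∷ ts))) (λ g → isLeaf g * ψ ts)
                 (λ g → ∑ (pruneIn ts) (λ q → ψ (g ∷ q)))) ⟩
    𝔑ᵀ (𝔓ᵀ (λ p → ψ (p ∷ ts))) t + 𝔑ᵀ (λ g → isLeaf g * ψ ts) t
      + ∑ (graftAll t) (λ g → ∑ (pruneIn ts) (λ q → ψ (g ∷ q)))
      ≡⟨ cong₂ _+_ (cong₂ _+_ (commutator t _) (𝔑ᵀ-isLeaf (ψ ts) t)) (∑-comm (graftAll t) (pruneIn ts) _) ⟩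
    PN + size t * c + 0 + X ∎

  grafts-in-ts : ∑ (graftForest ts) (λ q → ∑ (pruneIn (t ∷ q)) ψ) ≡ Y + L + (Z + suc (sizeList ts) * c)
  grafts-in-ts = begin
    ∑ (graftForest ts) (λ q → ∑ (pruneIn (t ∷ q)) ψ)
      ≡⟨ trans (∑-cong (graftForest ts) (λ q → ∑-pruneIn-∷ t q ψ))
           (∑-+₃ (graftForest ts) (λ q → 𝔓ᵀ (λ p → ψ (p ∷ q)) t) (λ q → isLeaf t * ψ q)
                 (λ q → ∑ (pruneIn q) (λ r → ψ (t ∷ r)))) ⟩
    ∑ (graftForest ts) (λ q → 𝔓ᵀ (λ p → ψ (p ∷ q)) t) + ∑ (graftForest ts) (λ q → isLeaf t * ψ q)
      + ∑ (graftForest ts) (λ q → ∑ (pruneIn q) (λ r → ψ (t ∷ r)))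
      ≡⟨ cong₂ _+_ (cong₂ _+_ (∑-comm (graftForest ts) (pruneAll t) _) (∑-*ˡ (isLeaf t) (graftForest ts) ψ))
                   (forest-commutator ts (λ r → ψ (t ∷ r))) ⟩
    Y + L + (Z + suc (sizeList ts) * c) ∎

  prunes : ∑ (pruneIn (t ∷ ts)) (λ ps → ∑ (graftForest ps) ψ) ≡ PN + Y + L + (X + Z)
  prunes = trans (∑-pruneIn-∷ t ts _) (cong₂ (λ a b → a + L + b)
    (trans (∑-cong (pruneAll t) (λ p → ∑-graftForest-∷ p ts ψ)) (∑-+ (pruneAll t) _ _))
    (trans (∑-cong (pruneIn ts) (λ q → ∑-graftForest-∷ t q ψ))
      (∑-+ (pruneIn ts) (λ q → 𝔑ᵀ (λ g → ψ (g ∷ q)) t) (λ q → ∑ (graftForest q) (λ r → ψ (t ∷ r))))))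

-- Iterated growth of the one-vertex tree

iterate : (A → A) → ℕ → A → A
iterate f zero    a = a
iterate f (suc n) a = iterate f n (f a)

iterate-suc : (f : A → A) (n : ℕ) (a : A) → iterate f (suc n) a ≡ f (iterate f n a)
iterate-suc f zero    a = refl
iterate-suc f (suc n) a = iterate-suc f n (f a)

iterate-𝔑ᵀ-cong : (n : ℕ) {φ ψ : Tree → ℕ} → (∀ u → φ u ≡ ψ u) →
  (t : Tree) → iterate 𝔑ᵀ n φ t ≡ iterate 𝔑ᵀ n ψ t
iterate-𝔑ᵀ-cong zero    φ≗ψ = φ≗ψ
iterate-𝔑ᵀ-cong (suc n) φ≗ψ = iterate-𝔑ᵀ-cong n (λ u → ∑-cong (graftAll u) φ≗ψ)

iterate-𝔑ᵀ-+ : (n : ℕ) (φ ψ : Tree → ℕ) (t : Tree) →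
  iterate 𝔑ᵀ n (λ u → φ u + ψ u) t ≡ iterate 𝔑ᵀ n φ t + iterate 𝔑ᵀ n ψ t
iterate-𝔑ᵀ-+ zero    φ ψ t = refl
iterate-𝔑ᵀ-+ (suc n) φ ψ t =
  trans (iterate-𝔑ᵀ-cong n (λ u → ∑-+ (graftAll u) φ ψ) t) (iterate-𝔑ᵀ-+ n (𝔑ᵀ φ) (𝔑ᵀ ψ) t)

iterate-𝔑ᵀ-∑ : (xs : List A) (n : ℕ) (K : A → Tree → ℕ) (t : Tree) →
  iterate 𝔑ᵀ n (λ u → ∑ xs (λ a → K a u)) t ≡ ∑ xs (λ a → iterate 𝔑ᵀ n (K a) t)
iterate-𝔑ᵀ-∑ xs zero    K t = refl
iterate-𝔑ᵀ-∑ xs (suc n) K t = trans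
  (iterate-𝔑ᵀ-cong n (λ u → ∑-comm (graftAll u) xs (λ g a → K a g)) t)
  (iterate-𝔑ᵀ-∑ xs n (λ a → 𝔑ᵀ (K a)) t)

iterate-𝔑ᵀ-size : (f : ℕ → ℕ) (φ : Tree → ℕ) (n : ℕ) (t : Tree) →
  iterate 𝔑ᵀ n (λ u → f (size u) * φ u) t ≡ f (size t + n) * iterate 𝔑ᵀ n φ t
iterate-𝔑ᵀ-size f φ zero    t = cong (λ m → f m * φ t) (sym (+-identityʳ (size t)))
iterate-𝔑ᵀ-size f φ (suc n) t = begin
  iterate 𝔑ᵀ n (𝔑ᵀ (λ u → f (size u) * φ u)) t
    ≡⟨ iterate-𝔑ᵀ-cong n (𝔑ᵀ-size f φ) t ⟩
  iterate 𝔑ᵀ n (λ u → f (suc (size u)) * 𝔑ᵀ φ u) t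
    ≡⟨ iterate-𝔑ᵀ-size (f ∘ suc) (𝔑ᵀ φ) n t ⟩
  f (suc (size t + n)) * iterate 𝔑ᵀ n (𝔑ᵀ φ) t
    ≡⟨ cong (λ m → f m * iterate 𝔑ᵀ n (𝔑ᵀ φ) t) (+-suc (size t) n) ⟨
  f (size t + suc n) * iterate 𝔑ᵀ (suc n) φ t ∎

iterate-𝔑ᵀ-commutator : (n : ℕ) (φ : Tree → ℕ) (t : Tree) →
  iterate 𝔑ᵀ n (𝔑ᵀ (𝔓ᵀ φ)) t ≡ iterate 𝔑ᵀ n (𝔓ᵀ (𝔑ᵀ φ)) t + (size t + n) * iterate 𝔑ᵀ n φ t
iterate-𝔑ᵀ-commutator n φ t = begin
  iterate 𝔑ᵀ n (𝔑ᵀ (𝔓ᵀ φ)) t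
    ≡⟨ iterate-𝔑ᵀ-cong n (λ u → commutator u φ) t ⟩
  iterate 𝔑ᵀ n (λ u → 𝔓ᵀ (𝔑ᵀ φ) u + size u * φ u) t
    ≡⟨ iterate-𝔑ᵀ-+ n (𝔓ᵀ (𝔑ᵀ φ)) (λ u → size u * φ u) t ⟩
  iterate 𝔑ᵀ n (𝔓ᵀ (𝔑ᵀ φ)) t + iterate 𝔑ᵀ n (λ u → size u * φ u) t
    ≡⟨ cong (iterate 𝔑ᵀ n (𝔓ᵀ (𝔑ᵀ φ)) t +_) (iterate-𝔑ᵀ-size (λ m → m) φ n t) ⟩
  iterate 𝔑ᵀ n (𝔓ᵀ (𝔑ᵀ φ)) t + (size t + n) * iterate 𝔑ᵀ n φ t ∎

𝔓𝔑^[1+j]• : (j : ℕ) (φ : Tree → ℕ) →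
  iterate 𝔑ᵀ (suc j) (𝔓ᵀ φ) • ≡ (suc (suc j) C 2) * iterate 𝔑ᵀ j φ •
𝔓𝔑^[1+j]• zero    φ = commutator • φ  -- 𝔓ᵀ (𝔑ᵀ φ) • is an empty sum and 2 C 2 evaluates to 1
𝔓𝔑^[1+j]• (suc j) φ = begin
  iterate 𝔑ᵀ (suc j) (𝔑ᵀ (𝔓ᵀ φ)) •
    ≡⟨ iterate-𝔑ᵀ-commutator (suc j) φ • ⟩
  iterate 𝔑ᵀ (suc j) (𝔓ᵀ (𝔑ᵀ φ)) • + suc (suc j) * X
    ≡⟨ cong (_+ suc (suc j) * X) (𝔓𝔑^[1+j]• j (𝔑ᵀ φ)) ⟩
  (suc (suc j) C 2) * X + suc (suc j) * X
    ≡⟨ *-distribʳ-+ X (suc (suc j) C 2) (suc (suc j)) ⟨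
  ((suc (suc j) C 2) + suc (suc j)) * X
    ≡⟨ cong (_* X) pascal ⟩
  (suc (suc (suc j)) C 2) * X ∎
  where
  X = iterate 𝔑ᵀ (suc j) φ •
  pascal : (suc (suc j) C 2) + suc (suc j) ≡ suc (suc (suc j)) C 2
  pascal = trans (+-comm _ (suc (suc j)))
    (trans (cong (_+ (suc (suc j) C 2)) (sym (nC1≡n (suc (suc j)))))
           (nCk+nC[k+1]≡[n+1]C[k+1] (suc (suc j)) 1))

#P≤#N : (w : List Letter) → All (λ s → #P s ≤ #N s) (suffixes w) → #P w ≤ #N w
#P≤#N []      _       = z≤n
#P≤#N (_ ∷ _) (p ∷ _) = p

eval-applyWord-• : (w : List Letter) (j : ℕ) (φ : Tree → ℕ) →
  All (λ s → #P s ≤ #N s) (suffixes w) → #N w ≡ #P w + j →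
  eval φ (applyWord w ((1 , •) ∷ [])) ≡ binomProd w * iterate 𝔑ᵀ j φ •
eval-applyWord-• []      j       φ _        refl = +-identityʳ (1 * φ •)
eval-applyWord-• (N ∷ w) zero    φ (_ ∷ ps) eq   =
  ⊥-elim (≤⇒≯ (#P≤#N w ps) (≤-reflexive (trans eq (+-identityʳ (#P w)))))
eval-applyWord-• (N ∷ w) (suc j) φ (_ ∷ ps) eq   = trans (eval-𝔑 φ (applyWord w ((1 , •) ∷ [])))
  (eval-applyWord-• w j (𝔑ᵀ φ) ps (suc-injective (trans eq (+-suc (#P w) j))))
eval-applyWord-• (P ∷ w) j       φ (_ ∷ ps) eq   = begin
  eval φ (𝔓 (applyWord w ((1 , •) ∷ [])))
    ≡⟨ eval-𝔓 φ (applyWord w ((1 , •) ∷ [])) ⟩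
  eval (𝔓ᵀ φ) (applyWord w ((1 , •) ∷ []))
    ≡⟨ eval-applyWord-• w (suc j) (𝔓ᵀ φ) ps (trans eq (sym (+-suc (#P w) j))) ⟩
  binomProd w * iterate 𝔑ᵀ (suc j) (𝔓ᵀ φ) •
    ≡⟨ cong (binomProd w *_) (𝔓𝔑^[1+j]• j φ) ⟩
  binomProd w * ((suc (suc j) C 2) * iterate 𝔑ᵀ j φ •)
    ≡⟨ *-CS.x∙yz≈yx∙z (binomProd w) (suc (suc j) C 2) (iterate 𝔑ᵀ j φ •) ⟩
  (suc (suc j) C 2) * binomProd w * iterate 𝔑ᵀ j φ •
    ≡⟨ cong (λ c → (c C 2) * binomProd w * iterate 𝔑ᵀ j φ •) (sym excess+2) ⟩
  binomProd (P ∷ w) * iterate 𝔑ᵀ j φ • ∎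
  where
  excess+2 : #N w ∸ suc (#P w) + 2 ≡ suc (suc j)
  excess+2 = trans (cong (λ n → n ∸ suc (#P w) + 2) eq)
    (trans (cong (_+ 2) (m+n∸m≡n (suc (#P w)) j)) (+-comm j 2))

-- The greedy isomorphism test is an equivalence relation

infix 4 _≅_

_≅_ : Tree → Tree → Set
a ≅ b = iso a b ≡ true

true≢false : true ≢ false
true≢false ()

remove-nothing : (t : Tree) (us : List Tree) → remove t us ≡ nothing → All (λ u → iso t u ≡ false) us
remove-nothing t []       _ = []
remove-nothing t (u ∷ us) eq with iso t u in t≇u
... | false with remove t us in eq′
...   | nothing = t≇u ∷ remove-nothing t us eq′

record Removal (t : Tree) (us r : List Tree) : Set where
  constructor removal
  field
    pre post : List Tree
    u        : Tree
    us≡      : us ≡ pre ++ u ∷ post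
    r≡       : r ≡ pre ++ post
    t≅u      : t ≅ u

remove-just : (t : Tree) (us r : List Tree) → remove t us ≡ just r → Removal t us r
remove-just t (u ∷ us) r eq with iso t u in t≅u
... | true with refl ← eq = removal [] us u refl refl t≅u
... | false with remove t us in eq′
...   | just r′ with refl ← eq with removal pre post v refl refl t≅v ← remove-just t us r′ eq′ =
  removal (u ∷ pre) post v refl refl t≅v

Match : List Tree → List Tree → Set
Match as bs = ∃[ bs′ ] (bs ↭ bs′ × Pointwise _≅_ as bs′)

isoList-sound : (as bs : List Tree) → isoList as bs ≡ true → Match as bs
isoList-sound []       []      _  = [] , ↭-refl , []
isoList-sound (a ∷ as) bs      eq with remove a bs in removed
... | just r with removal pre post u refl refl a≅u ← remove-just a bs r removed
               with bs′ , p , as≅bs′ ← isoList-sound as (pre ++ post) eq =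
  u ∷ bs′ , ↭-trans (shift u pre post) (prep u p) , a≅u ∷ as≅bs′

Pointwise-↭ʳ : {S : A → A → Set} {xs ys xs′ : List A} → Pointwise S xs ys → xs ↭ xs′ →
  ∃[ ys′ ] (ys ↭ ys′ × Pointwise S xs′ ys′)
Pointwise-↭ʳ pw ↭.refl = _ , ↭-refl , pw
Pointwise-↭ʳ (s ∷ pw) (prep x p) with ys′ , q , pw′ ← Pointwise-↭ʳ pw p = _ , prep _ q , s ∷ pw′
Pointwise-↭ʳ (s₁ ∷ s₂ ∷ pw) (swap x y p) with ys′ , q , pw′ ← Pointwise-↭ʳ pw p =
  _ , swap _ _ q , s₂ ∷ s₁ ∷ pw′
Pointwise-↭ʳ pw (↭.trans p₁ p₂) with ys₁ , q₁ , pw₁ ← Pointwise-↭ʳ pw p₁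
                                  with ys₂ , q₂ , pw₂ ← Pointwise-↭ʳ pw₁ p₂ = ys₂ , ↭-trans q₁ q₂ , pw₂

Pointwise-↭ˡ : {S : A → A → Set} {xs ys ys′ : List A} → Pointwise S xs ys → ys ↭ ys′ →
  ∃[ xs′ ] (xs ↭ xs′ × Pointwise S xs′ ys′)
Pointwise-↭ˡ pw p with xs′ , q , pw′ ← Pointwise-↭ʳ (Pointwise.symmetric (λ s → s) pw) p =
  xs′ , q , Pointwise.symmetric (λ s → s) pw′

record IsoLaws (a : Tree) : Set where
  field
    refl-at  : a ≅ a
    sym-at   : {b : Tree} → a ≅ b → b ≅ a
    trans-at : {b c : Tree} → a ≅ b → b ≅ c → a ≅ c

open IsoLaws

Match-↭ : {as bs cs : List Tree} → cs ↭ bs → Match as bs → Match as cs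
Match-↭ q (bs′ , p , as≅bs′) = bs′ , ↭-trans q p , as≅bs′

rematch : {as Y W : List Tree} {u₀ b₁ : Tree} → All IsoLaws as →
  ({a′ : Tree} → IsoLaws a′ → a′ ≅ u₀ → a′ ≅ b₁) →
  Pointwise _≅_ as Y → Y ↭ u₀ ∷ W → Match as (b₁ ∷ W)
rematch laws-as replace as≅Y p
  with (a′ ∷ as′) , q , (a′≅u₀ ∷ as′≅W) ← Pointwise-↭ˡ as≅Y p
  with laws-a′ ∷ _ ← All-resp-↭ q laws-as
  = Pointwise-↭ʳ (replace laws-a′ a′≅u₀ ∷ as′≅W) (↭-sym q)

-- The greedy matcher pairs a with the first u₀ ≅ a; a perfect matching pairing a with b₁
-- instead is repaired by handing b₁ to the partner a′ of u₀, since a′ ≅ u₀ ≅ a ≅ b₁.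
exchange : {a u₀ b₁ : Tree} {X Y as : List Tree} → IsoLaws a → All IsoLaws as →
  a ≅ u₀ → a ≅ b₁ → u₀ ∷ X ↭ b₁ ∷ Y → Pointwise _≅_ as Y → Match as X
exchange {a} {u₀} {b₁} {X} {Y} laws-a laws-as a≅u₀ a≅b₁ p as≅Y with ∈-resp-↭ (↭-sym p) (here refl)
... | here refl = Y , drop-∷ p , as≅Y
... | there b₁∈X with X₁ , X₂ , refl ← ∈-∃++ b₁∈X =
  Match-↭ (shift b₁ X₁ X₂) (rematch laws-as a′≅b₁ as≅Y Y↭u₀∷X₁X₂)
  where
  Y↭u₀∷X₁X₂ : Y ↭ u₀ ∷ X₁ ++ X₂
  Y↭u₀∷X₁X₂ = drop-∷ (↭-trans (↭-sym p) (↭-trans (prep u₀ (shift b₁ X₁ X₂)) (swap u₀ b₁ ↭-refl)))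
  a′≅b₁ : {a′ : Tree} → IsoLaws a′ → a′ ≅ u₀ → a′ ≅ b₁
  a′≅b₁ laws-a′ a′≅u₀ = trans-at laws-a′ (trans-at laws-a′ a′≅u₀ (sym-at laws-a a≅u₀)) a≅b₁

isoList-complete : (as bs : List Tree) → All IsoLaws as → Match as bs → isoList as bs ≡ true
isoList-complete []       bs _ (.[] , p , []) with refl ← ↭-empty-inv p = refl
isoList-complete (a ∷ as) bs (laws-a ∷ laws-as) ((b₁ ∷ Y) , p , (a≅b₁ ∷ as≅Y)) with remove a bs in removed
... | nothing = ⊥-elim (true≢false (trans (sym a≅b₁)
                  (All.lookup (remove-nothing a bs removed) (∈-resp-↭ (↭-sym p) (here refl)))))
... | just r with removal pre post u₀ refl refl a≅u₀ ← remove-just a bs r removed =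
  isoList-complete as (pre ++ post) laws-as
    (exchange laws-a laws-as a≅u₀ a≅b₁ (↭-trans (↭-sym (shift u₀ pre post)) p) as≅Y)

sizeList≡sum : (ts : List Tree) → sizeList ts ≡ sum (map size ts)
sizeList≡sum []       = refl
sizeList≡sum (t ∷ ts) = cong (size t +_) (sizeList≡sum ts)

sizeList-↭ : {ts us : List Tree} → ts ↭ us → sizeList ts ≡ sizeList us
sizeList-↭ {ts} {us} p = trans (sizeList≡sum ts) (trans (sum-↭ (↭-map⁺ size p)) (sym (sizeList≡sum us)))

size-≅ : (a b : Tree) → a ≅ b → size a ≡ size b
sizeList-≅ : (as bs : List Tree) → Pointwise _≅_ as bs → sizeList as ≡ sizeList bs
size-≅ (node as) (node bs) a≅b with bs′ , p , as≅bs′ ← isoList-sound as bs a≅b =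
  cong suc (trans (sizeList-≅ as bs′ as≅bs′) (sym (sizeList-↭ p)))
sizeList-≅ []       []       []            = refl
sizeList-≅ (a ∷ as) (b ∷ bs) (a≅b ∷ as≅bs) = cong₂ _+_ (size-≅ a b a≅b) (sizeList-≅ as bs as≅bs)

Pointwise-refl-at : {as : List Tree} → All IsoLaws as → Pointwise _≅_ as as
Pointwise-refl-at []               = []
Pointwise-refl-at (laws ∷ laws-as) = refl-at laws ∷ Pointwise-refl-at laws-as

Pointwise-sym-at : {as bs : List Tree} → All IsoLaws as → Pointwise _≅_ as bs → Pointwise _≅_ bs as
Pointwise-sym-at []               []              = []
Pointwise-sym-at (laws ∷ laws-as) (a≅b ∷ as≅bs) = sym-at laws a≅b ∷ Pointwise-sym-at laws-as as≅bs

Pointwise-trans-at : {as bs cs : List Tree} → All IsoLaws as →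
  Pointwise _≅_ as bs → Pointwise _≅_ bs cs → Pointwise _≅_ as cs
Pointwise-trans-at []               []              []              = []
Pointwise-trans-at (laws ∷ laws-as) (a≅b ∷ as≅bs) (b≅c ∷ bs≅cs) =
  trans-at laws a≅b b≅c ∷ Pointwise-trans-at laws-as as≅bs bs≅cs

-- Induction on a size bound rather than on the tree: symmetry at node as needs the laws at the
-- children of an arbitrary tree isomorphic to it, which have the same sizes (sizeList-≅).
isoLaws≤     : (n : ℕ) (a : Tree) → size a ≤ n → IsoLaws a
isoLaws≤-All : (n : ℕ) (as : List Tree) → sizeList as ≤ n → All IsoLaws as

isoLaws≤ (suc n) (node as) (s≤s as≤n) = record
  { refl-at  = refl′
  ; sym-at   = λ {b} → sym′ {b}
  ; trans-at = λ {b} {c} → trans′ {b} {c}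
  }
  where
  laws-as : All IsoLaws as
  laws-as = isoLaws≤-All n as as≤n

  refl′ : node as ≅ node as
  refl′ = isoList-complete as as laws-as (as , ↭-refl , Pointwise-refl-at laws-as)

  sym′ : {b : Tree} → node as ≅ b → b ≅ node as
  sym′ {node bs} as≅bs
    with bs′ , p , as≅bs′ ← isoList-sound as bs as≅bs
    with as′ , q , bs≅as′ ← Pointwise-↭ʳ (Pointwise-sym-at laws-as as≅bs′) (↭-sym p)
    = isoList-complete bs as laws-bs (as′ , q , bs≅as′)
    where
    laws-bs : All IsoLaws bs
    laws-bs = All-resp-↭ (↭-sym p)
      (isoLaws≤-All n bs′ (subst (_≤ n) (sizeList-≅ as bs′ as≅bs′) as≤n))

  trans′ : {b c : Tree} → node as ≅ b → b ≅ c → node as ≅ c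
  trans′ {node bs} {node cs} as≅bs bs≅cs
    with bs′ , p , as≅bs′ ← isoList-sound as bs as≅bs
    with cs′ , q , bs≅cs′ ← isoList-sound bs cs bs≅cs
    with cs″ , r , bs′≅cs″ ← Pointwise-↭ʳ bs≅cs′ p
    = isoList-complete as cs laws-as (cs″ , ↭-trans q r , Pointwise-trans-at laws-as as≅bs′ bs′≅cs″)

isoLaws≤-All n []       _  = []
isoLaws≤-All n (a ∷ as) ≤n =
  isoLaws≤ n a (≤-trans (m≤m+n (size a) (sizeList as)) ≤n) ∷
  isoLaws≤-All n as (≤-trans (m≤n+m (sizeList as) (size a)) ≤n)

isoLaws : (a : Tree) → IsoLaws a
isoLaws a = isoLaws≤ (size a) a ≤-refl

≅-refl : (a : Tree) → a ≅ a
≅-refl a = refl-at (isoLaws a)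

≅-sym : {a b : Tree} → a ≅ b → b ≅ a
≅-sym {a} = sym-at (isoLaws a)

≅-trans : {a b c : Tree} → a ≅ b → b ≅ c → a ≅ c
≅-trans {a} = trans-at (isoLaws a)

𝟙 : Bool → ℕ
𝟙 true  = 1
𝟙 false = 0

iso-resp-≅ : {t u : Tree} → t ≅ u → (y : Tree) → iso y t ≡ iso y u
iso-resp-≅ {t} {u} t≅u y =
  ⇔→≡ (mk⇔ (λ y≅t → ≅-trans {y} {t} y≅t t≅u) (λ y≅u → ≅-trans {y} {u} y≅u (≅-sym {t} t≅u)))

iso-false-sym : {a b : Tree} → iso a b ≡ false → iso b a ≡ false
iso-false-sym {a} {b} a≇b with iso b a in b≅a
... | true  = ⊥-elim (true≢false (trans (sym (≅-sym {b} b≅a)) a≇b))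
... | false = refl

count : Tree → List Tree → ℕ
count y us = ∑ us (𝟙 ∘ iso y)

count-++-∷ : (y : Tree) (pre : List Tree) (u : Tree) (post : List Tree) →
  count y (pre ++ u ∷ post) ≡ 𝟙 (iso y u) + count y (pre ++ post)
count-++-∷ y pre u post = begin
  count y (pre ++ u ∷ post)                  ≡⟨ ∑-++ pre (u ∷ post) (𝟙 ∘ iso y) ⟩
  count y pre + (𝟙 (iso y u) + count y post) ≡⟨ +-CS.x∙yz≈y∙xz (count y pre) (𝟙 (iso y u)) (count y post) ⟩
  𝟙 (iso y u) + (count y pre + count y post) ≡⟨ cong (𝟙 (iso y u) +_) (∑-++ pre post (𝟙 ∘ iso y)) ⟨
  𝟙 (iso y u) + count y (pre ++ post)        ∎

count-remove-nothing : (t : Tree) (us : List Tree) → remove t us ≡ nothing → count t us ≡ 0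
count-remove-nothing t us removed =
  trans (∑-cong-All (All.map (cong 𝟙) (remove-nothing t us removed))) (∑-zero us)

infix 4 _≋_

_≋_ : List Tree → List Tree → Set
ts ≋ us = (y : Tree) → count y ts ≡ count y us

≋-∷-cancel : {t u : Tree} {r r′ : List Tree} → t ≅ u → t ∷ r ≋ u ∷ r′ → r ≋ r′
≋-∷-cancel {t} {u} {r} {r′} t≅u t∷r≋u∷r′ y = +-cancelˡ-≡ (𝟙 (iso y t)) _ _
  (trans (t∷r≋u∷r′ y) (cong (λ b → 𝟙 b + count y r′) (sym (iso-resp-≅ t≅u y))))

count-remove-just : (t : Tree) (us : List Tree) {r : List Tree} → remove t us ≡ just r → us ≋ t ∷ r
count-remove-just t us {r} removed y with removal pre post u refl refl t≅u ← remove-just t us r removed =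
  trans (count-++-∷ y pre u post) (cong (_+ count y (pre ++ post)) (cong 𝟙 (sym (iso-resp-≅ t≅u y))))

isoList⇒≋ : (ts us : List Tree) → isoList ts us ≡ true → ts ≋ us
isoList⇒≋ []       []  _  y = refl
isoList⇒≋ (t ∷ ts) us eq y with remove t us in removed
... | just r = trans (cong (𝟙 (iso y t) +_) (isoList⇒≋ ts r eq y)) (sym (count-remove-just t us removed y))

≋⇒isoList : (ts us : List Tree) → ts ≋ us → isoList ts us ≡ true
≋⇒isoList []       []       _      = refl
≋⇒isoList []       (u ∷ us) []≋us =
  ⊥-elim (0≢1+n (trans ([]≋us u) (cong (λ b → 𝟙 b + count u us) (≅-refl u))))
≋⇒isoList (t ∷ ts) us       ts≋us with remove t us in removed
... | nothing = ⊥-elim (1+n≢0 (begin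
  suc (count t ts)            ≡⟨ cong (λ b → 𝟙 b + count t ts) (≅-refl t) ⟨
  count t (t ∷ ts)            ≡⟨ ts≋us t ⟩
  count t us                  ≡⟨ count-remove-nothing t us removed ⟩
  0                           ∎))
... | just r = ≋⇒isoList ts r
  (≋-∷-cancel {r = ts} {r′ = r} (≅-refl t) (λ y → trans (ts≋us y) (count-remove-just t us removed y)))

isoList-resp-≋ : (ts : List Tree) {r r′ : List Tree} → r ≋ r′ → isoList ts r ≡ isoList ts r′
isoList-resp-≋ ts {r} {r′} r≋r′ = ⇔→≡ (mk⇔
  (λ eq → ≋⇒isoList ts r′ (λ y → trans (isoList⇒≋ ts r eq y) (r≋r′ y)))
  (λ eq → ≋⇒isoList ts r (λ y → trans (isoList⇒≋ ts r′ eq y) (sym (r≋r′ y)))))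

weight : Tree → List (Tree × ℕ) → ℕ
weight y cs = ∑ cs (λ c → 𝟙 (iso y (proj₁ c)) * proj₂ c)

Disjoint : List (Tree × ℕ) → Set
Disjoint = AllPairs (λ c d → iso (proj₁ c) (proj₁ d) ≡ false)

All-addClass : (Q : Tree → Set) (t : Tree) (cs : List (Tree × ℕ)) →
  All (Q ∘ proj₁) cs → Q t → All (Q ∘ proj₁) (addClass t cs)
All-addClass Q t []             []         Qt = Qt ∷ []
All-addClass Q t ((s , m) ∷ cs) (Qs ∷ Qcs) Qt with iso t s
... | true  = Qs ∷ Qcs
... | false = Qs ∷ All-addClass Q t cs Qcs Qt

Disjoint-addClass : (t : Tree) (cs : List (Tree × ℕ)) → Disjoint cs → Disjoint (addClass t cs)
Disjoint-addClass t []             []        = [] ∷ []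
Disjoint-addClass t ((s , m) ∷ cs) (s∉ ∷ ds) with iso t s in t≅s
... | true  = s∉ ∷ ds
... | false = All-addClass (λ x → iso s x ≡ false) t cs s∉ (iso-false-sym {t} t≅s) ∷ Disjoint-addClass t cs ds

weight-addClass : (t : Tree) (cs : List (Tree × ℕ)) → (y : Tree) →
  weight y (addClass t cs) ≡ 𝟙 (iso y t) + weight y cs
weight-addClass t []             y = cong (_+ 0) (*-identityʳ (𝟙 (iso y t)))
weight-addClass t ((s , m) ∷ cs) y with iso t s in t≅s
... | true  = begin
  𝟙 (iso y s) * suc m + weight y cs     ≡⟨ cong (λ b → 𝟙 b * suc m + weight y cs) (iso-resp-≅ t≅s y) ⟨
  𝟙 (iso y t) * suc m + weight y cs     ≡⟨ cong (_+ weight y cs) (*-suc (𝟙 (iso y t)) m) ⟩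
  𝟙 (iso y t) + 𝟙 (iso y t) * m + weight y cs
                                        ≡⟨ +-assoc (𝟙 (iso y t)) _ _ ⟩
  𝟙 (iso y t) + (𝟙 (iso y t) * m + weight y cs)
                                        ≡⟨ cong (λ b → 𝟙 (iso y t) + (𝟙 b * m + weight y cs)) (iso-resp-≅ t≅s y) ⟩
  𝟙 (iso y t) + (𝟙 (iso y s) * m + weight y cs) ∎
... | false = trans (cong (𝟙 (iso y s) * m +_) (weight-addClass t cs y))
                    (+-CS.x∙yz≈y∙xz (𝟙 (iso y s) * m) (𝟙 (iso y t)) (weight y cs))

weight-absent : (t s : Tree) (cs : List (Tree × ℕ)) → All (λ c → iso s (proj₁ c) ≡ false) cs →
  t ≅ s → weight t cs ≡ 0
weight-absent t s []              []          t≅s = refl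
weight-absent t s ((s′ , m) ∷ cs) (s≇s′ ∷ ss) t≅s with iso t s′ in t≅s′
... | true  = ⊥-elim (true≢false (trans (sym (≅-trans {s} {t} (≅-sym {t} t≅s) t≅s′)) s≇s′))
... | false = weight-absent t s cs ss t≅s

classFact-addClass : (t : Tree) (cs : List (Tree × ℕ)) → Disjoint cs →
  classFact (addClass t cs) ≡ suc (weight t cs) * classFact cs
classFact-addClass t []             []        = refl
classFact-addClass t ((s , m) ∷ cs) (s∉ ∷ ds) with iso t s in t≅s
... | true rewrite weight-absent t s cs s∉ t≅s = regroup (m !) (classFact cs) m
  where regroup : ∀ a b m → (a + m * a) * b ≡ suc (m + 0 + 0) * (a * b)
        regroup = solve-∀
... | false = trans (cong (m ! *_) (classFact-addClass t cs ds))
                    (*-CS.x∙yz≈y∙xz (m !) (suc (weight t cs)) (classFact cs))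

classes-invariant : (ts : List Tree) → Disjoint (classes ts) × ((y : Tree) → weight y (classes ts) ≡ count y ts)
classes-invariant []       = [] , (λ y → refl)
classes-invariant (t ∷ ts) with ds , weights ← classes-invariant ts =
  Disjoint-addClass t (classes ts) ds ,
  λ y → trans (weight-addClass t (classes ts) y) (cong (𝟙 (iso y t) +_) (weights y))

sg-node-∷ : (t : Tree) (ts : List Tree) → sg (node (t ∷ ts)) ≡ suc (count t ts) * sg t * sg (node ts)
sg-node-∷ t ts with ds , weights ← classes-invariant ts = begin
  classFact (addClass t (classes ts)) * (sg t * sgList ts)
    ≡⟨ cong (_* (sg t * sgList ts)) (trans (classFact-addClass t (classes ts) ds)
         (cong (λ w → suc w * classFact (classes ts)) (weights t))) ⟩
  suc (count t ts) * classFact (classes ts) * (sg t * sgList ts)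
    ≡⟨ regroup (suc (count t ts)) (classFact (classes ts)) (sg t) (sgList ts) ⟩
  suc (count t ts) * sg t * sg (node ts) ∎
  where regroup : ∀ a b c d → a * b * (c * d) ≡ a * c * (b * d)
        regroup = solve-∀

-- Adjointness of growth and pruning

⟨_,_⟩ : Tree → Tree → ℕ
⟨ t , u ⟩ = 𝟙 (iso t u) * sg t

⟨_,_⟩ᶠ : List Tree → List Tree → ℕ
⟨ ts , us ⟩ᶠ = ⟨ node ts , node us ⟩

⟨⟩ᶠ-resp-≋ : (ts : List Tree) {r r′ : List Tree} → r ≋ r′ → ⟨ ts , r ⟩ᶠ ≡ ⟨ ts , r′ ⟩ᶠ
⟨⟩ᶠ-resp-≋ ts r≋r′ = cong (λ b → 𝟙 b * sg (node ts)) (isoList-resp-≋ ts r≋r′)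

selections : List A → List (A × List A)
selections []       = []
selections (u ∷ us) = (u , us) ∷ map (map₂ (u ∷_)) (selections us)

∑-selections-∷ : (x : A) (xs : List A) (H : A × List A → ℕ) →
  ∑ (selections (x ∷ xs)) H ≡ H (x , xs) + ∑ (selections xs) (H ∘ map₂ (x ∷_))
∑-selections-∷ x xs H = cong (H (x , xs) +_) (∑-map _ (selections xs) H)

∑-selections-≅ : (t : Tree) (us : List Tree) (G : List Tree → ℕ) (c : ℕ) →
  ((u : Tree) (r : List Tree) → t ≅ u → us ≋ u ∷ r → G r ≡ c) →
  ∑ (selections us) (λ s → 𝟙 (iso t (proj₁ s)) * G (proj₂ s)) ≡ count t us * c
∑-selections-≅ t []       G c G≡c = refl
∑-selections-≅ t (u ∷ us) G c G≡c = begin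
  𝟙 (iso t u) * G us + ∑ (map (map₂ (u ∷_)) (selections us)) (λ s → 𝟙 (iso t (proj₁ s)) * G (proj₂ s))
    ≡⟨ cong₂ _+_ head (trans (∑-map _ (selections us) _) (∑-selections-≅ t us (G ∘ (u ∷_)) c G∘u∷≡c)) ⟩
  𝟙 (iso t u) * c + count t us * c
    ≡⟨ *-distribʳ-+ c (𝟙 (iso t u)) (count t us) ⟨
  count t (u ∷ us) * c ∎
  where
  head : 𝟙 (iso t u) * G us ≡ 𝟙 (iso t u) * c
  head with iso t u in t≅u
  ... | true  = cong (1 *_) (G≡c u us t≅u (λ y → refl))
  ... | false = refl
  G∘u∷≡c : (u′ : Tree) (r : List Tree) → t ≅ u′ → us ≋ u′ ∷ r → G (u ∷ r) ≡ c
  G∘u∷≡c u′ r t≅u′ us≋u′∷r = G≡c u′ (u ∷ r) t≅u′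
    (λ y → trans (cong (𝟙 (iso y u) +_) (us≋u′∷r y)) (+-CS.x∙yz≈y∙xz (𝟙 (iso y u)) (𝟙 (iso y u′)) (count y r)))

∑-selections-absent : (t : Tree) (us : List Tree) (G : List Tree → ℕ) → remove t us ≡ nothing →
  ∑ (selections us) (λ s → 𝟙 (iso t (proj₁ s)) * G (proj₂ s)) ≡ 0
∑-selections-absent t us G removed = trans
  (∑-selections-≅ t us G 0 (λ u r t≅u us≋u∷r → ⊥-elim (0≢1+n (begin
    0                       ≡⟨ count-remove-nothing t us removed ⟨
    count t us              ≡⟨ us≋u∷r t ⟩
    𝟙 (iso t u) + count t r ≡⟨ cong (λ b → 𝟙 b + count t r) t≅u ⟩
    suc (count t r)         ∎))))
  (*-zeroʳ (count t us))

∑-selections-present : (t : Tree) (ts us : List Tree) {r : List Tree} → remove t us ≡ just r →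
  ∑ (selections us) (λ s → 𝟙 (iso t (proj₁ s)) * (sg t * ⟨ ts , proj₂ s ⟩ᶠ)) ≡
  count t us * (sg t * ⟨ ts , r ⟩ᶠ)
∑-selections-present t ts us {r} removed =
  ∑-selections-≅ t us _ _ (λ u r′ t≅u us≋u∷r′ → cong (sg t *_) (⟨⟩ᶠ-resp-≋ ts
    (≋-∷-cancel {r = r′} {r′ = r} (≅-sym {t} t≅u)
      (λ y → trans (sym (us≋u∷r′ y)) (count-remove-just t us removed y)))))

count-remove-just-≅ : (t : Tree) (ts us : List Tree) {r : List Tree} → remove t us ≡ just r →
  isoList ts r ≡ true → count t us ≡ suc (count t ts)
count-remove-just-≅ t ts us {r} removed ts≅r =
  trans (count-remove-just t us removed t) (cong₂ (λ b n → 𝟙 b + n) (≅-refl t) (sym (isoList⇒≋ ts r ts≅r t)))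

⟨⟩ᶠ-∷-present : (t : Tree) (ts us : List Tree) {r : List Tree} → remove t us ≡ just r →
  𝟙 (isoList ts r) * sg (node (t ∷ ts)) ≡ count t us * (sg t * ⟨ ts , r ⟩ᶠ)
⟨⟩ᶠ-∷-present t ts us {r} removed with isoList ts r in ts≅r
... | false = sym (trans (cong (count t us *_) (*-zeroʳ (sg t))) (*-zeroʳ (count t us)))
... | true  = begin
  1 * sg (node (t ∷ ts))                          ≡⟨ *-identityˡ (sg (node (t ∷ ts))) ⟩
  sg (node (t ∷ ts))                              ≡⟨ sg-node-∷ t ts ⟩
  suc (count t ts) * sg t * sg (node ts)          ≡⟨ regroup (suc (count t ts)) (sg t) (sg (node ts)) ⟩
  suc (count t ts) * (sg t * (1 * sg (node ts)))  ≡⟨ cong (λ n → n * (sg t * (1 * sg (node ts))))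
                                                        (count-remove-just-≅ t ts us removed ts≅r) ⟨
  count t us * (sg t * (1 * sg (node ts)))        ∎
  where regroup : ∀ a b c → a * b * c ≡ a * (b * (1 * c))
        regroup = solve-∀

-- Orbit–stabiliser at the root: sg (node (t ∷ ts)) carries the factor 1 + count t ts
-- (sg-node-∷), which is the number of ways to select a child u ≅ t of node us.
⟨⟩ᶠ-∷ : (t : Tree) (ts us : List Tree) →
  ⟨ t ∷ ts , us ⟩ᶠ ≡ ∑ (selections us) (λ s → ⟨ t , proj₁ s ⟩ * ⟨ ts , proj₂ s ⟩ᶠ)
⟨⟩ᶠ-∷ t ts us =
  trans first-child (sym (∑-cong (selections us) (λ s → *-assoc (𝟙 (iso t (proj₁ s))) (sg t) _)))
  where
  first-child : 𝟙 (isoList (t ∷ ts) us) * sg (node (t ∷ ts)) ≡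
                ∑ (selections us) (λ s → 𝟙 (iso t (proj₁ s)) * (sg t * ⟨ ts , proj₂ s ⟩ᶠ))
  first-child with remove t us in removed
  ... | nothing = sym (∑-selections-absent t us _ removed)
  ... | just r  = trans (⟨⟩ᶠ-∷-present t ts us removed) (sym (∑-selections-present t ts us removed))

∑-pruneIn-selections : (F : Tree → List Tree → ℕ) (xs : List Tree) →
  ∑ (pruneIn xs) (λ ps → ∑ (selections ps) (uncurry F)) ≡
  ∑ (selections xs) (λ s → ∑ (pruneIn (proj₂ s)) (F (proj₁ s)) + 𝔓ᵀ (λ q → F q (proj₂ s)) (proj₁ s))
∑-pruneIn-selections F []       = refl
∑-pruneIn-selections F (x ∷ xs) = begin
  ∑ (pruneIn (x ∷ xs)) T        ≡⟨ prune-then-select ⟩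
  PA + PB + Lx + (D + (I + J))  ≡⟨ regroup PA PB Lx D I J ⟩
  D + PA + (PB + Lx + I + J)    ≡⟨ select-then-prune ⟨
  ∑ (selections (x ∷ xs)) H     ∎
  where
  T : List Tree → ℕ
  T ps = ∑ (selections ps) (uncurry F)
  H : Tree × List Tree → ℕ
  H s = ∑ (pruneIn (proj₂ s)) (F (proj₁ s)) + 𝔓ᵀ (λ q → F q (proj₂ s)) (proj₁ s)
  PA = 𝔓ᵀ (λ p → F p xs) x
  PB = 𝔓ᵀ (λ p → ∑ (selections xs) (λ s → F (proj₁ s) (p ∷ proj₂ s))) x
  Lx = isLeaf x * T xs
  D  = ∑ (pruneIn xs) (F x)
  I  = ∑ (selections xs) (λ s → ∑ (pruneIn (proj₂ s)) (λ q → F (proj₁ s) (x ∷ q)))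
  J  = ∑ (selections xs) (λ s → 𝔓ᵀ (λ q → F q (x ∷ proj₂ s)) (proj₁ s))

  regroup : ∀ a b c d i j → a + b + c + (d + (i + j)) ≡ d + a + (b + c + i + j)
  regroup = solve-∀

  prune-then-select : ∑ (pruneIn (x ∷ xs)) T ≡ PA + PB + Lx + (D + (I + J))
  prune-then-select = trans (∑-pruneIn-∷ x xs T) (cong₂ (λ a b → a + Lx + b)
    (trans (∑-cong (pruneAll x) (λ p → ∑-selections-∷ p xs (uncurry F)))
           (∑-+ (pruneAll x) (λ p → F p xs) _))
    (trans (∑-cong (pruneIn xs) (λ q → ∑-selections-∷ x q (uncurry F)))
           (trans (∑-+ (pruneIn xs) (F x) _)
                  (cong (D +_) (trans (∑-pruneIn-selections (λ a r → F a (x ∷ r)) xs)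
                                      (∑-+ (selections xs) _ _))))))

  select-then-prune : ∑ (selections (x ∷ xs)) H ≡ D + PA + (PB + Lx + I + J)
  select-then-prune = trans (∑-selections-∷ x xs H) (cong (D + PA +_) (begin
    ∑ (selections xs) (H ∘ map₂ (x ∷_))
      ≡⟨ ∑-cong (selections xs) (λ s → cong (_+ 𝔓ᵀ (λ q → F q (x ∷ proj₂ s)) (proj₁ s))
           (∑-pruneIn-∷ x (proj₂ s) (F (proj₁ s)))) ⟩
    ∑ (selections xs) (λ s → 𝔓ᵀ (λ p → F (proj₁ s) (p ∷ proj₂ s)) x + isLeaf x * F (proj₁ s) (proj₂ s)
                             + ∑ (pruneIn (proj₂ s)) (λ q → F (proj₁ s) (x ∷ q))
                             + 𝔓ᵀ (λ q → F q (x ∷ proj₂ s)) (proj₁ s))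
      ≡⟨ trans (∑-+ (selections xs) _ _) (cong (_+ J) (∑-+₃ (selections xs) _ _ _)) ⟩
    ∑ (selections xs) (λ s → 𝔓ᵀ (λ p → F (proj₁ s) (p ∷ proj₂ s)) x)
      + ∑ (selections xs) (λ s → isLeaf x * F (proj₁ s) (proj₂ s)) + I + J
      ≡⟨ cong (λ n → n + I + J)
           (cong₂ _+_ (∑-comm (selections xs) (pruneAll x) _) (∑-*ˡ (isLeaf x) (selections xs) _)) ⟩
    PB + Lx + I + J ∎))

isoList-•-∷-∷ : (a b : Tree) (rest : List Tree) → isoList (• ∷ []) (a ∷ b ∷ rest) ≡ false
isoList-•-∷-∷ a b rest with iso • a
... | true  = refl
... | false with remove • (b ∷ rest)
...   | nothing = refl
...   | just _  = refl

adjoint : (t x : Tree) → 𝔑ᵀ (λ g → ⟨ g , x ⟩) t ≡ 𝔓ᵀ (λ p → ⟨ t , p ⟩) x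
forest-adjoint : (ts xs : List Tree) →
  ∑ (graftForest ts) (λ gs → ⟨ gs , xs ⟩ᶠ) ≡ ∑ (pruneIn xs) (λ ps → ⟨ ts , ps ⟩ᶠ)

adjoint (node ts) (node xs) =
  trans (𝔑ᵀ-node _ ts) (trans (forest-adjoint ts xs) (sym (𝔓ᵀ-node _ xs)))

-- For ts = [] both sides are 1 if xs is a single leaf and 0 otherwise.
forest-adjoint []       []                      = refl
forest-adjoint []       (node [] ∷ [])          = refl
forest-adjoint []       (node (s ∷ ss) ∷ [])    = sym (trans (∑-++ (map _ (pruneAll (node (s ∷ ss)))) [] _)
  (cong (_+ 0) (trans (∑-map _ (pruneAll (node (s ∷ ss))) _) (∑-zero (pruneAll (node (s ∷ ss)))))))
forest-adjoint []       (a ∷ b ∷ rest)          = begin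
  𝟙 (isoList (• ∷ []) (a ∷ b ∷ rest)) * 1 + 0
    ≡⟨ cong (λ b → 𝟙 b * 1 + 0) (isoList-•-∷-∷ a b rest) ⟩
  0
    ≡⟨ trans (∑-pruneIn-∷ a (b ∷ rest) _) (cong₂ _+_ (cong₂ _+_ (∑-zero (pruneAll a)) (*-zeroʳ (isLeaf a)))
                                                     (∑-zero (pruneIn (b ∷ rest)))) ⟨
  ∑ (pruneIn (a ∷ b ∷ rest)) (λ ps → ⟨ [] , ps ⟩ᶠ) ∎
forest-adjoint (t ∷ ts) xs = begin
  ∑ (graftForest (t ∷ ts)) (λ gs → ⟨ gs , xs ⟩ᶠ)
    ≡⟨ ∑-graftForest-∷ t ts _ ⟩
  𝔑ᵀ (λ g → ⟨ g ∷ ts , xs ⟩ᶠ) t + ∑ (graftForest ts) (λ q → ⟨ t ∷ q , xs ⟩ᶠ)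
    ≡⟨ cong₂ _+_ grafts-at-t grafts-in-ts ⟩
  ∑ (selections xs) prune-selected + ∑ (selections xs) prune-rest
    ≡⟨ trans (+-comm (∑ (selections xs) prune-selected) _)
             (sym (∑-+ (selections xs) prune-rest prune-selected)) ⟩
  ∑ (selections xs) (λ s → ∑ (pruneIn (proj₂ s)) (F (proj₁ s)) + 𝔓ᵀ (λ q → F q (proj₂ s)) (proj₁ s))
    ≡⟨ ∑-pruneIn-selections F xs ⟨
  ∑ (pruneIn xs) (λ ps → ∑ (selections ps) (uncurry F))
    ≡⟨ ∑-cong (pruneIn xs) (λ ps → ⟨⟩ᶠ-∷ t ts ps) ⟨
  ∑ (pruneIn xs) (λ ps → ⟨ t ∷ ts , ps ⟩ᶠ) ∎
  where
  F : Tree → List Tree → ℕ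
  F u r = ⟨ t , u ⟩ * ⟨ ts , r ⟩ᶠ
  prune-rest prune-selected : Tree × List Tree → ℕ
  prune-rest     s = ∑ (pruneIn (proj₂ s)) (F (proj₁ s))
  prune-selected s = 𝔓ᵀ (λ q → F q (proj₂ s)) (proj₁ s)

  grafts-at-t : 𝔑ᵀ (λ g → ⟨ g ∷ ts , xs ⟩ᶠ) t ≡ ∑ (selections xs) prune-selected
  grafts-at-t = begin
    𝔑ᵀ (λ g → ⟨ g ∷ ts , xs ⟩ᶠ) t
      ≡⟨ ∑-cong (graftAll t) (λ g → ⟨⟩ᶠ-∷ g ts xs) ⟩
    ∑ (graftAll t) (λ g → ∑ (selections xs) (λ s → ⟨ g , proj₁ s ⟩ * ⟨ ts , proj₂ s ⟩ᶠ))
      ≡⟨ ∑-comm (graftAll t) (selections xs) _ ⟩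
    ∑ (selections xs) (λ s → ∑ (graftAll t) (λ g → ⟨ g , proj₁ s ⟩ * ⟨ ts , proj₂ s ⟩ᶠ))
      ≡⟨ ∑-cong (selections xs) (λ s → begin
           ∑ (graftAll t) (λ g → ⟨ g , proj₁ s ⟩ * ⟨ ts , proj₂ s ⟩ᶠ)
             ≡⟨ ∑-*ʳ _ (graftAll t) _ ⟩
           𝔑ᵀ (λ g → ⟨ g , proj₁ s ⟩) t * ⟨ ts , proj₂ s ⟩ᶠ
             ≡⟨ cong (_* ⟨ ts , proj₂ s ⟩ᶠ) (adjoint t (proj₁ s)) ⟩
           𝔓ᵀ (λ q → ⟨ t , q ⟩) (proj₁ s) * ⟨ ts , proj₂ s ⟩ᶠ
             ≡⟨ ∑-*ʳ _ (pruneAll (proj₁ s)) _ ⟨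
           prune-selected s ∎) ⟩
    ∑ (selections xs) prune-selected ∎

  grafts-in-ts : ∑ (graftForest ts) (λ q → ⟨ t ∷ q , xs ⟩ᶠ) ≡
                 ∑ (selections xs) prune-rest
  grafts-in-ts = begin
    ∑ (graftForest ts) (λ q → ⟨ t ∷ q , xs ⟩ᶠ)
      ≡⟨ ∑-cong (graftForest ts) (λ q → ⟨⟩ᶠ-∷ t q xs) ⟩
    ∑ (graftForest ts) (λ q → ∑ (selections xs) (λ s → ⟨ t , proj₁ s ⟩ * ⟨ q , proj₂ s ⟩ᶠ))
      ≡⟨ ∑-comm (graftForest ts) (selections xs) _ ⟩
    ∑ (selections xs) (λ s → ∑ (graftForest ts) (λ q → ⟨ t , proj₁ s ⟩ * ⟨ q , proj₂ s ⟩ᶠ))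
      ≡⟨ ∑-cong (selections xs) (λ s → trans
           (∑-*ˡ ⟨ t , proj₁ s ⟩ (graftForest ts) (λ q → ⟨ q , proj₂ s ⟩ᶠ))
           (trans (cong (⟨ t , proj₁ s ⟩ *_) (forest-adjoint ts (proj₂ s)))
                  (sym (∑-*ˡ ⟨ t , proj₁ s ⟩ (pruneIn (proj₂ s)) (λ ps → ⟨ ts , ps ⟩ᶠ))))) ⟩
    ∑ (selections xs) prune-rest ∎

iterate-adjoint : (n : ℕ) (t x : Tree) →
  iterate 𝔑ᵀ n (λ u → ⟨ u , x ⟩) t ≡ iterate 𝔓ᵀ n (λ p → ⟨ t , p ⟩) x
iterate-adjoint zero    t x = refl
iterate-adjoint (suc n) t x = begin
  iterate 𝔑ᵀ n (𝔑ᵀ (λ u → ⟨ u , x ⟩)) t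
    ≡⟨ iterate-𝔑ᵀ-cong n (λ u → adjoint u x) t ⟩
  iterate 𝔑ᵀ n (λ u → ∑ (pruneAll x) (λ p → ⟨ u , p ⟩)) t
    ≡⟨ iterate-𝔑ᵀ-∑ (pruneAll x) n (λ p u → ⟨ u , p ⟩) t ⟩
  ∑ (pruneAll x) (λ p → iterate 𝔑ᵀ n (λ u → ⟨ u , p ⟩) t)
    ≡⟨ ∑-cong (pruneAll x) (iterate-adjoint n t) ⟩
  𝔓ᵀ (iterate 𝔓ᵀ n (λ p → ⟨ t , p ⟩)) x
    ≡⟨ cong-app (iterate-suc 𝔓ᵀ n _) x ⟨
  iterate 𝔓ᵀ (suc n) (λ p → ⟨ t , p ⟩) x ∎

⟪⟫-singleton : (V : Vect) (x : Tree) → ⟪ V , (1 , x) ∷ [] ⟫ ≡ eval (λ t → ⟨ t , x ⟩) V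
⟪⟫-singleton []            x = refl
⟪⟫-singleton ((c , t) ∷ V) x = cong₂ _+_ term (⟪⟫-singleton V x)
  where
  term : (if iso t x then c * 1 * sg t else 0) + 0 ≡ c * (𝟙 (iso t x) * sg t)
  term with iso t x
  ... | true  = trans (+-identityʳ _)
                  (trans (cong (_* sg t) (*-identityʳ c)) (cong (c *_) (sym (*-identityˡ (sg t)))))
  ... | false = sym (*-zeroʳ c)

coeff-• : (V : Vect) → coeff • V ≡ eval (λ s → ⟨ • , s ⟩) V
coeff-• []            = refl
coeff-• ((c , s) ∷ V) = cong₂ _+_ term (coeff-• V)
  where
  term : (if iso • s then c else 0) ≡ c * (𝟙 (iso • s) * 1)
  term with iso • s
  ... | true  = sym (*-identityʳ c)
  ... | false = sym (*-zeroʳ c)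

eval-iter-𝔓 : (n : ℕ) (φ : Tree → ℕ) (V : Vect) → eval φ (iter n 𝔓 V) ≡ eval (iterate 𝔓ᵀ n φ) V
eval-iter-𝔓 zero    φ V = refl
eval-iter-𝔓 (suc n) φ V = trans (eval-𝔓 φ (iter n 𝔓 V)) (eval-iter-𝔓 n (𝔓ᵀ φ) V)

m-• : (k : ℕ) (x : Tree) → size x ≡ suc k → m • x ≡ iterate 𝔓ᵀ k (λ p → ⟨ • , p ⟩) x
m-• k x size≡ = begin
  coeff • (iter (size x ∸ 1) 𝔓 ((1 , x) ∷ []))
    ≡⟨ cong (λ n → coeff • (iter (n ∸ 1) 𝔓 ((1 , x) ∷ []))) size≡ ⟩
  coeff • (iter k 𝔓 ((1 , x) ∷ []))
    ≡⟨ coeff-• (iter k 𝔓 ((1 , x) ∷ [])) ⟩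
  eval (λ s → ⟨ • , s ⟩) (iter k 𝔓 ((1 , x) ∷ []))
    ≡⟨ eval-iter-𝔓 k (λ s → ⟨ • , s ⟩) ((1 , x) ∷ []) ⟩
  1 * iterate 𝔓ᵀ k (λ p → ⟨ • , p ⟩) x + 0
    ≡⟨ trans (+-identityʳ _) (*-identityˡ _) ⟩
  iterate 𝔓ᵀ k (λ p → ⟨ • , p ⟩) x ∎

proposition2p7 : (k : ℕ) (x : Tree) (w : List Letter) →
    size x ≡ suc k → ValidWord k w →
    ⟪ applyWord w ((1 , •) ∷ []) , (1 , x) ∷ [] ⟫ ≡ m • x * binomProd w
proposition2p7 k x w size≡ (balanced-suffixes , excess≡k) = begin
  ⟪ applyWord w ((1 , •) ∷ []) , (1 , x) ∷ [] ⟫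
    ≡⟨ ⟪⟫-singleton (applyWord w ((1 , •) ∷ [])) x ⟩
  eval (λ t → ⟨ t , x ⟩) (applyWord w ((1 , •) ∷ []))
    ≡⟨ eval-applyWord-• w k (λ t → ⟨ t , x ⟩) balanced-suffixes excess≡k ⟩
  binomProd w * iterate 𝔑ᵀ k (λ t → ⟨ t , x ⟩) •
    ≡⟨ cong (binomProd w *_) (iterate-adjoint k • x) ⟩
  binomProd w * iterate 𝔓ᵀ k (λ p → ⟨ • , p ⟩) x
    ≡⟨ cong (binomProd w *_) (m-• k x size≡) ⟨
  binomProd w * m • x
    ≡⟨ *-comm (binomProd w) (m • x) ⟩
  m • x * binomProd w ∎
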